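{- Let $G = C_n$ be the cycle on $n \ge 3$ vertices and let $Q = \{a,b\}$ with $a\neq b$ vertices of $G$. If $a$ and $b$ are adjacent, then there is a unique maximal absolute $c_Q$-visible set of $G$. If $a$ and $b$ are non-adjacent, then any two distinct maximal absolute $c_Q$-visible sets of $G$ are disjoint.
   Context: For a graph $G$ and $X \subseteq V(G)$, two vertices $u,v$ are $X$-visible if there exists a shortest $(u,v)$-path $P$ in $G$ with $V(P)\cap X \subseteq \{u,v\}$; a set $Y$ is $X$-visible if every two vertices of $Y$ are $X$-visible. A set $X\subseteq V(G)$ is a mutual-visibility set of $G$ if it is $X$-visible. For $Q\subseteq V(G)$, a set $W\subseteq \overline{Q}=V(G)\setminus Q$ is $c_Q$-visible if $W$ is $Q$-visible and $u,w$ are $Q$-visible for all $u\in Q$, $w\in W$; it is an absolute $c_Q$-visible set if moreover $Q$ is a mutual-visibility set of $G$. An absolute $c_Q$-visible set is maximal if it is not a proper subset of any other absolute $c_Q$-visible set. -}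

module Defs where

open import Data.Nat using (ℕ; zero; suc; _<_; _∸_)
open import Data.Fin using (Fin; toℕ)
open import Data.Fin.Subset using (Subset; _∈_; _∉_; _⊆_; ∁)
open import Data.Product using (Σ; ∃; _×_; _,_)
open import Data.Sum using (_⊎_)
open import Data.Empty using (⊥)
open import Relation.Nullary using (¬_)
open import Relation.Binary.PropositionalEquality using (_≡_; _≢_)

Graph : ℕ → Set₁
Graph n = Fin n → Fin n → Set

module _ {n : ℕ} (G : Graph n) where

  data Walk : ℕ → Fin n → Fin n → Set where
    nil  : ∀ {u} → Walk zero u u
    cons : ∀ {k u w v} → G u w → Walk k w v → Walk (suc k) u v

  data OnWalk (x : Fin n) : ∀ {k u v} → Walk k u v → Set where
    here  : ∀ {k v} {p : Walk k x v} → OnWalk x p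
    there : ∀ {k u w v} {e : G u w} {p : Walk k w v} →
            OnWalk x p → OnWalk x (cons e p)

  -- a shortest (u,v)-path: a (u,v)-walk of length k such that no
  -- (u,v)-walk is shorter (such a walk is necessarily a path)
  IsShortest : ∀ {k u v} → Walk k u v → Set
  IsShortest {k} {u} {v} _ = ∀ m → m < k → ¬ Walk m u v

  Visible : Subset n → Fin n → Fin n → Set
  Visible X u v =
    Σ ℕ λ k → Σ (Walk k u v) λ P →
      IsShortest P × (∀ x → OnWalk x P → x ∈ X → (x ≡ u) ⊎ (x ≡ v))

  SetVisible : Subset n → Subset n → Set
  SetVisible X Y = ∀ u v → u ∈ Y → v ∈ Y → Visible X u v

  MutualVisibilitySet : Subset n → Set
  MutualVisibilitySet X = SetVisible X X

  CQVisible : Subset n → Subset n → Set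
  CQVisible Q W =
    W ⊆ ∁ Q × SetVisible Q W × (∀ u w → u ∈ Q → w ∈ W → Visible Q u w)

  AbsoluteCQVisible : Subset n → Subset n → Set
  AbsoluteCQVisible Q W = CQVisible Q W × MutualVisibilitySet Q

  MaximalAbsoluteCQVisible : Subset n → Subset n → Set
  MaximalAbsoluteCQVisible Q W =
    AbsoluteCQVisible Q W ×
    (∀ W' → AbsoluteCQVisible Q W' → W ⊆ W' → W' ≡ W)

CycleAdj : (n : ℕ) → Fin n → Fin n → Set
CycleAdj n i j =
  (suc (toℕ i) ≡ toℕ j) ⊎ (suc (toℕ j) ≡ toℕ i) ⊎
  ((toℕ i ≡ n ∸ 1) × (toℕ j ≡ 0)) ⊎ ((toℕ j ≡ n ∸ 1) × (toℕ i ≡ 0))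

Cycle : (n : ℕ) → Graph n
Cycle n = CycleAdj n

{-# OPTIONS --safe #-}
-- Write n = N + 1 and give every vertex y its position pos y ∈ {0, …, N}, counted from the
-- successor of a, so that a sits at N, b at β = pos b, and N ~ 0 is the only edge whose positions
-- are not consecutive. The cycle distance is Dist s t = min ∣s − t∣ (n − ∣s − t∣). So an arc is a
-- shortest path exactly when its length is at most n/2 (WithinHalf). A shortest path that avoids
-- a vertex at position 0 or N cannot use the edge N ~ 0, so its endpoints are within half the
-- cycle of each other.
--
-- Suppose maximal sets W and W′ share a vertex x. Every u ∈ W and v ∈ W′ are seen from b, so each
-- is within half the cycle of b. They are seen from x by paths avoiding a and b, so they lie on
-- the same side of b as x. Then u and v see each other along the arc between them. Hence W ∪ W′
-- is absolute c_Q-visible, and maximality gives W = W′. If b follows a (β = 0), visibility from a and from b confines every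
-- admissible vertex to an explicit arc W₀. This arc is itself absolute c_Q-visible, so it is the
-- unique maximal set.
module Submission where

open import Defs
open import Data.Nat using (ℕ; zero; suc; _+_; _*_; _∸_; _≤_; _<_; _⊓_; ∣_-_∣; z≤n; s≤s; _≤?_; _<?_)
open import Data.Nat.Properties
open import Data.Nat.DivMod using (_%_; _mod_; m%n<n; m%n%n≡m%n; %-distribˡ-+; [m+n]%n≡m%n; [m+kn]%n≡m%n; m≤n⇒m%n≡m; m<n⇒m%n≡m; n%n≡0)
open import Data.Nat.Tactic.RingSolver using (solve-∀)
open import Data.Fin using (Fin; toℕ)
open import Data.Fin.Properties using (toℕ<n; toℕ-injective; toℕ-fromℕ<)
open import Data.Fin.Subset using (Subset; _∈_; _∉_; _∪_; ⁅_⁆; ∁; _⊆_)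
open import Data.Fin.Subset.Properties using (x∈⁅x⁆; x∈⁅y⁆⇒x≡y; x∈p∪q⁻; x∈p∪q⁺; x∈∁p⇒x∉p; x∉p⇒x∈∁p; ⊆-antisym; p⊆p∪q; q⊆p∪q; ∪-comm)
open import Data.Vec using (tabulate)
open import Data.Vec.Properties using (lookup∘tabulate; []=⇒lookup; lookup⇒[]=)
open import Data.Product using (Σ; _×_; _,_; proj₁; proj₂)
open import Data.Sum using (_⊎_; inj₁; inj₂; swap; [_,_])
open import Data.Unit using (⊤; tt)
open import Data.Empty using (⊥; ⊥-elim)
open import Function using (_∘_; _⇔_; mk⇔; Equivalence)
open import Relation.Nullary using (¬_; yes; no; does; _×-dec_)
open import Relation.Nullary.Decidable using (dec-true)
open import Relation.Binary.Definitions using (Tri; tri<; tri≈; tri>)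
open import Relation.Unary using (Decidable)
open import Relation.Binary.PropositionalEquality using (_≡_; _≢_; refl; sym; trans; cong; subst; module ≡-Reasoning)

∈-pair⁻ : ∀ {n} {a b x : Fin n} → x ∈ ⁅ a ⁆ ∪ ⁅ b ⁆ → x ≡ a ⊎ x ≡ b
∈-pair⁻ {a = a} {b} x∈ with x∈p∪q⁻ ⁅ a ⁆ ⁅ b ⁆ x∈
... | inj₁ x∈a = inj₁ (x∈⁅y⁆⇒x≡y a x∈a)
... | inj₂ x∈b = inj₂ (x∈⁅y⁆⇒x≡y b x∈b)

module WalkProperties {n : ℕ} (G : Graph n) where

  _++_ : ∀ {k l u v w} → Walk G k u v → Walk G l v w → Walk G (k + l) u w
  nil ++ R = R
  cons e P ++ R = cons e (P ++ R)

  onWalk-nil : ∀ {x u} → OnWalk G x (nil {u = u}) → x ≡ u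
  onWalk-nil here = refl

  potential-≤-length : (f : Fin n → ℕ) (ok : Fin n → Set) →
    (∀ {y z} → ok y → ok z → G y z → f y ≤ suc (f z)) →
    ∀ {k u v} (P : Walk G k u v) → (∀ x → OnWalk G x P → ok x) → f u ≤ k + f v
  potential-≤-length f ok lip nil _ = ≤-refl
  potential-≤-length f ok lip (cons e P) okP =
    ≤-trans (lip (okP _ here) (okP _ (there here)) e)
            (s≤s (potential-≤-length f ok lip P (λ x → okP x ∘ there)))

  walk-preserves : (R ok : Fin n → Set) →
    (∀ {y z} → ok y → ok z → G y z → R y → R z) →
    ∀ {k u v} (P : Walk G k u v) → (∀ x → OnWalk G x P → ok x) → R u → R v
  walk-preserves R ok step nil _ r = r
  walk-preserves R ok step (cons e P) okP r =
    walk-preserves R ok step P (λ x → okP x ∘ there) (step (okP _ here) (okP _ (there here)) e r)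

  shortest-≤ : ∀ {k l u v} {P : Walk G k u v} → IsShortest G P → Walk G l u v → k ≤ l
  shortest-≤ sh R = ≮⇒≥ (λ l<k → sh _ l<k R)

  visible-refl : ∀ {X u} → Visible G X u u
  visible-refl = 0 , nil , (λ _ ()) , λ x o _ → inj₁ (onWalk-nil o)

  mutualVisibility-pair :
    (∀ u v → Σ ℕ λ k → Σ (Walk G k u v) (IsShortest G)) →
    ∀ a b → MutualVisibilitySet G (⁅ a ⁆ ∪ ⁅ b ⁆)
  mutualVisibility-pair shortest a b u v u∈ v∈ with ∈-pair⁻ u∈ | ∈-pair⁻ v∈
  ... | inj₁ refl | inj₁ refl = visible-refl
  ... | inj₂ refl | inj₂ refl = visible-refl
  ... | inj₁ refl | inj₂ refl = let (k , P , sh) = shortest a b in k , P , sh , λ _ _ → ∈-pair⁻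
  ... | inj₂ refl | inj₁ refl = let (k , P , sh) = shortest b a in k , P , sh , λ _ _ → swap ∘ ∈-pair⁻

  module Symmetric (sym-adj : ∀ {u v} → G u v → G v u) where

    snoc : ∀ {k u v w} → Walk G k u v → G v w → Walk G (suc k) u w
    snoc nil e = cons e nil
    snoc (cons e′ P) e = cons e′ (snoc P e)

    reverse : ∀ {k u v} → Walk G k u v → Walk G k v u
    reverse nil = nil
    reverse (cons e P) = snoc (reverse P) (sym-adj e)

    onWalk-snoc : ∀ {x k u v w} (P : Walk G k u v) {e : G v w} →
                  OnWalk G x (snoc P e) → OnWalk G x P ⊎ x ≡ w
    onWalk-snoc nil here = inj₁ here
    onWalk-snoc nil (there o) = inj₂ (onWalk-nil o)
    onWalk-snoc (cons e′ P) here = inj₁ here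
    onWalk-snoc (cons e′ P) (there o) with onWalk-snoc P o
    ... | inj₁ o′ = inj₁ (there o′)
    ... | inj₂ x≡w = inj₂ x≡w

    onWalk-reverse : ∀ {x k u v} (P : Walk G k u v) → OnWalk G x (reverse P) → OnWalk G x P
    onWalk-reverse nil o = o
    onWalk-reverse (cons e P) o with onWalk-snoc (reverse P) o
    ... | inj₁ o′ = there (onWalk-reverse P o′)
    ... | inj₂ refl = here

    reverse-shortest : ∀ {k u v} {P : Walk G k u v} → IsShortest G P → IsShortest G (reverse P)
    reverse-shortest sh m m<k R = sh m m<k (reverse R)

    visible-sym : ∀ {X u v} → Visible G X u v → Visible G X v u
    visible-sym (k , P , sh , av) = k , reverse P , reverse-shortest {P = P} sh , λ x o x∈X →
      swap (av x (onWalk-reverse P o) x∈X)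

HasUniqueMaximal : ∀ {n} → Graph n → Subset n → Set
HasUniqueMaximal {n} G Q =
  Σ (Subset n) λ W → MaximalAbsoluteCQVisible G Q W × (∀ W′ → MaximalAbsoluteCQVisible G Q W′ → W′ ≡ W)

module CQVisibleSets {n : ℕ} (G : Graph n) (Q : Subset n) where

  Absolute : Subset n → Set
  Absolute = AbsoluteCQVisible G Q

  Maximal : Subset n → Set
  Maximal = MaximalAbsoluteCQVisible G Q

  ∪-absolute : ∀ {W W′} → Absolute W → Absolute W′ →
    (∀ {u v} → u ∈ W → v ∈ W′ → Visible G Q u v × Visible G Q v u) →
    Absolute (W ∪ W′)
  ∪-absolute {W} {W′} ((W⊆ , visW , visQW) , mutQ) ((W′⊆ , visW′ , visQW′) , _) cross =
    (⊆∁Q , visible , fromQ) , mutQ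
    where
      ⊆∁Q : W ∪ W′ ⊆ ∁ Q
      ⊆∁Q x∈ with x∈p∪q⁻ W W′ x∈
      ... | inj₁ x∈W = W⊆ x∈W
      ... | inj₂ x∈W′ = W′⊆ x∈W′
      visible : SetVisible G Q (W ∪ W′)
      visible u v u∈ v∈ with x∈p∪q⁻ W W′ u∈ | x∈p∪q⁻ W W′ v∈
      ... | inj₁ u∈W | inj₁ v∈W = visW u v u∈W v∈W
      ... | inj₂ u∈W′ | inj₂ v∈W′ = visW′ u v u∈W′ v∈W′
      ... | inj₁ u∈W | inj₂ v∈W′ = proj₁ (cross u∈W v∈W′)
      ... | inj₂ u∈W′ | inj₁ v∈W = proj₂ (cross v∈W u∈W′)
      fromQ : ∀ u w → u ∈ Q → w ∈ W ∪ W′ → Visible G Q u w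
      fromQ u w u∈Q w∈ with x∈p∪q⁻ W W′ w∈
      ... | inj₁ w∈W = visQW u w u∈Q w∈W
      ... | inj₂ w∈W′ = visQW′ u w u∈Q w∈W′

  maximal-∪-absolute⇒≡ : ∀ {W W′} → Maximal W → Maximal W′ → Absolute (W ∪ W′) → W ≡ W′
  maximal-∪-absolute⇒≡ {W} {W′} (_ , maxW) (_ , maxW′) abs∪ =
    trans (sym (maxW (W ∪ W′) abs∪ (p⊆p∪q W′))) (maxW′ (W ∪ W′) abs∪ (q⊆p∪q W W′))

  greatest⇒unique-maximal : ∀ {W} → Absolute W → (∀ W′ → Absolute W′ → W′ ⊆ W) → HasUniqueMaximal G Q
  greatest⇒unique-maximal {W} absW greatest = W ,
    (absW , λ W′ absW′ W⊆W′ → ⊆-antisym (greatest W′ absW′) W⊆W′) ,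
    λ W′ (absW′ , maxW′) → sym (maxW′ W absW (greatest W′ absW′))

fromDec : ∀ {n} {P : Fin n → Set} → Decidable P → Subset n
fromDec P? = tabulate (does ∘ P?)

∈-fromDec⁺ : ∀ {n} {P : Fin n → Set} (P? : Decidable P) {x} → P x → x ∈ fromDec P?
∈-fromDec⁺ P? {x} px = lookup⇒[]= x _ (trans (lookup∘tabulate _ x) (dec-true (P? x) px))

∈-fromDec⁻ : ∀ {n} {P : Fin n → Set} (P? : Decidable P) {x} → x ∈ fromDec P? → P x
∈-fromDec⁻ P? {x} x∈ with P? x | trans (sym (lookup∘tabulate (does ∘ P?) x)) ([]=⇒lookup x∈)
... | yes px | _ = px
... | no _ | ()

module CycleArithmetic (N : ℕ) where

  Step : ℕ → ℕ → Set
  Step s t = suc s ≡ t ⊎ (s ≡ N × t ≡ 0)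

  Adjacentℕ : ℕ → ℕ → Set
  Adjacentℕ s t = Step s t ⊎ Step t s

  step⇒suc-% : ∀ {s t} → Step s t → suc s % suc N ≡ t % suc N
  step⇒suc-% (inj₁ refl) = refl
  step⇒suc-% (inj₂ (refl , refl)) = n%n≡0 (suc N)

  suc-%⇒step : ∀ {s t} → s ≤ N → t ≤ N → suc s % suc N ≡ t % suc N → Step s t
  suc-%⇒step s≤N t≤N eq with m≤n⇒m<n∨m≡n s≤N
  ... | inj₁ s<N = inj₁ (trans (sym (m≤n⇒m%n≡m s<N)) (trans eq (m≤n⇒m%n≡m t≤N)))
  ... | inj₂ refl = inj₂ (refl , trans (sym (m≤n⇒m%n≡m t≤N)) (trans (sym eq) (n%n≡0 (suc N))))

  %-absorbˡ : ∀ x y → (x + y) % suc N ≡ (x % suc N + y) % suc N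
  %-absorbˡ x y = begin
    (x + y) % suc N                           ≡⟨ %-distribˡ-+ x y (suc N) ⟩
    (x % suc N + y % suc N) % suc N
      ≡⟨ cong (λ r → (r + y % suc N) % suc N) (sym (m%n%n≡m%n x (suc N))) ⟩
    (x % suc N % suc N + y % suc N) % suc N   ≡⟨ sym (%-distribˡ-+ (x % suc N) y (suc N)) ⟩
    (x % suc N + y) % suc N                   ∎
    where open ≡-Reasoning

  suc-% : ∀ x → suc (x % suc N) % suc N ≡ suc x % suc N
  suc-% x = begin
    (1 + x % suc N) % suc N        ≡⟨ cong (_% suc N) (+-comm 1 (x % suc N)) ⟩
    (x % suc N + 1) % suc N        ≡⟨ sym (%-absorbˡ x 1) ⟩
    (x + 1) % suc N                ≡⟨ cong (_% suc N) (+-comm x 1) ⟩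
    (1 + x) % suc N                ∎
    where open ≡-Reasoning

  %-translate : ∀ x y c → x % suc N ≡ y % suc N ⇔ (x + c) % suc N ≡ (y + c) % suc N
  %-translate x y c = mk⇔ to from
    where
      open ≡-Reasoning
      to : x % suc N ≡ y % suc N → (x + c) % suc N ≡ (y + c) % suc N
      to eq = begin
        (x + c) % suc N          ≡⟨ %-absorbˡ x c ⟩
        (x % suc N + c) % suc N  ≡⟨ cong (λ r → (r + c) % suc N) eq ⟩
        (y % suc N + c) % suc N  ≡⟨ sym (%-absorbˡ y c) ⟩
        (y + c) % suc N          ∎
      -- adding c * N completes the translation by c to a multiple of suc N
      untranslate : ∀ z → ((z + c) + c * N) % suc N ≡ z % suc N
      untranslate z = begin
        ((z + c) + c * N) % suc N  ≡⟨ cong (_% suc N) (shuffle z c N) ⟩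
        (z + c * suc N) % suc N    ≡⟨ [m+kn]%n≡m%n z c (suc N) ⟩
        z % suc N                  ∎
        where
          shuffle : ∀ z c N → (z + c) + c * N ≡ z + c * suc N
          shuffle = solve-∀
      from : (x + c) % suc N ≡ (y + c) % suc N → x % suc N ≡ y % suc N
      from eq = begin
        x % suc N                                 ≡⟨ sym (untranslate x) ⟩
        ((x + c) + c * N) % suc N                 ≡⟨ %-absorbˡ (x + c) (c * N) ⟩
        ((x + c) % suc N + c * N) % suc N         ≡⟨ cong (λ r → (r + c * N) % suc N) eq ⟩
        ((y + c) % suc N + c * N) % suc N         ≡⟨ sym (%-absorbˡ (y + c) (c * N)) ⟩
        ((y + c) + c * N) % suc N                 ≡⟨ untranslate y ⟩
        y % suc N                                 ∎

  cycleAdj⇒adjacentℕ : ∀ {y z} → CycleAdj (suc N) y z → Adjacentℕ (toℕ y) (toℕ z)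
  cycleAdj⇒adjacentℕ (inj₁ e) = inj₁ (inj₁ e)
  cycleAdj⇒adjacentℕ (inj₂ (inj₁ e)) = inj₂ (inj₁ e)
  cycleAdj⇒adjacentℕ (inj₂ (inj₂ (inj₁ e))) = inj₁ (inj₂ e)
  cycleAdj⇒adjacentℕ (inj₂ (inj₂ (inj₂ e))) = inj₂ (inj₂ e)

  adjacentℕ⇒cycleAdj : ∀ {y z} → Adjacentℕ (toℕ y) (toℕ z) → CycleAdj (suc N) y z
  adjacentℕ⇒cycleAdj (inj₁ (inj₁ e)) = inj₁ e
  adjacentℕ⇒cycleAdj (inj₂ (inj₁ e)) = inj₂ (inj₁ e)
  adjacentℕ⇒cycleAdj (inj₁ (inj₂ e)) = inj₂ (inj₂ (inj₁ e))
  adjacentℕ⇒cycleAdj (inj₂ (inj₂ e)) = inj₂ (inj₂ (inj₂ e))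

  Dist : ℕ → ℕ → ℕ
  Dist s t = ∣ s - t ∣ ⊓ (suc N ∸ ∣ s - t ∣)

  dist-self : ∀ t → Dist t t ≡ 0
  dist-self t rewrite ∣n-n∣≡0 t = refl

  dist-comm : ∀ s t → Dist s t ≡ Dist t s
  dist-comm s t rewrite ∣-∣-comm s t = refl

  ∣-∣-suc : ∀ s t → ∣ s - t ∣ ≤ suc ∣ suc s - t ∣ × ∣ suc s - t ∣ ≤ suc ∣ s - t ∣
  ∣-∣-suc s t =
      ≤-trans (∣-∣-triangle s (suc s) t) (≤-reflexive (cong (_+ ∣ suc s - t ∣) ∣s-1+s∣≡1))
    , ≤-trans (∣-∣-triangle (suc s) s t)
              (≤-reflexive (cong (_+ ∣ s - t ∣) (trans (∣-∣-comm (suc s) s) ∣s-1+s∣≡1)))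
    where
      ∣s-1+s∣≡1 : ∣ s - suc s ∣ ≡ 1
      ∣s-1+s∣≡1 = trans (m≤n⇒∣m-n∣≡n∸m (n≤1+n s)) (m+n∸n≡m 1 s)

  ∸-suc-≤ : ∀ m x → m ∸ x ≤ suc (m ∸ suc x)
  ∸-suc-≤ zero zero = z≤n
  ∸-suc-≤ zero (suc x) = z≤n
  ∸-suc-≤ (suc m) zero = ≤-refl
  ∸-suc-≤ (suc m) (suc x) = ∸-suc-≤ m x

  ∸-lipschitz : ∀ m {x x′} → x′ ≤ suc x → m ∸ x ≤ suc (m ∸ x′)
  ∸-lipschitz m {x} x′≤ = ≤-trans (∸-suc-≤ m x) (s≤s (∸-monoʳ-≤ m x′≤))

  dist-suc : ∀ s t → Dist s t ≤ suc (Dist (suc s) t) × Dist (suc s) t ≤ suc (Dist s t)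
  dist-suc s t =
      ⊓-mono-≤ up (∸-lipschitz (suc N) down)
    , ⊓-mono-≤ down (∸-lipschitz (suc N) up)
    where
      up = proj₁ (∣-∣-suc s t)
      down = proj₂ (∣-∣-suc s t)

  dist-top : ∀ t → t ≤ N → Dist N t ≡ (N ∸ t) ⊓ suc t
  dist-top t t≤N = begin
    ∣ N - t ∣ ⊓ (suc N ∸ ∣ N - t ∣)  ≡⟨ cong (λ d → d ⊓ (suc N ∸ d)) (m≤n⇒∣n-m∣≡n∸m t≤N) ⟩
    (N ∸ t) ⊓ (suc N ∸ (N ∸ t))      ≡⟨ cong ((N ∸ t) ⊓_) (+-∸-assoc 1 (m∸n≤m N t)) ⟩
    (N ∸ t) ⊓ suc (N ∸ (N ∸ t))      ≡⟨ cong (λ r → (N ∸ t) ⊓ suc r) (m∸[m∸n]≡n t≤N) ⟩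
    (N ∸ t) ⊓ suc t                  ∎
    where open ≡-Reasoning

  dist-bottom : ∀ t → t ≤ N → Dist 0 t ≡ t ⊓ suc (N ∸ t)
  dist-bottom t t≤N = cong (t ⊓_) (+-∸-assoc 1 t≤N)

  dist-wrap : ∀ t → t ≤ N → Dist N t ≤ suc (Dist 0 t) × Dist 0 t ≤ suc (Dist N t)
  dist-wrap t t≤N rewrite dist-top t t≤N | dist-bottom t t≤N =
      ≤-trans (≤-reflexive (⊓-comm (N ∸ t) (suc t)))
              (⊓-mono-≤ ≤-refl (≤-trans (n≤1+n _) (s≤s (n≤1+n _))))
    , ≤-trans (≤-reflexive (⊓-comm t (suc (N ∸ t))))
              (⊓-mono-≤ ≤-refl (≤-trans (n≤1+n _) (n≤1+n _)))

  dist-step : ∀ {s s′ t} → t ≤ N → Step s s′ → Dist s t ≤ suc (Dist s′ t) × Dist s′ t ≤ suc (Dist s t)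
  dist-step {s} {t = t} _ (inj₁ refl) = dist-suc s t
  dist-step {t = t} t≤N (inj₂ (refl , refl)) = dist-wrap t t≤N

  dist-adjacent : ∀ {s s′ t} → t ≤ N → Adjacentℕ s s′ → Dist s t ≤ suc (Dist s′ t)
  dist-adjacent t≤N (inj₁ step) = proj₁ (dist-step t≤N step)
  dist-adjacent t≤N (inj₂ step) = proj₂ (dist-step t≤N step)

  WithinHalf : ℕ → ℕ → Set
  WithinHalf s t = ∣ s - t ∣ + ∣ s - t ∣ ≤ suc N

  withinHalf-sym : ∀ {s t} → WithinHalf s t → WithinHalf t s
  withinHalf-sym {s} {t} = subst (λ d → d + d ≤ suc N) (∣-∣-comm s t)

  withinHalf⇒≤dist : ∀ {s t} → WithinHalf s t → ∣ s - t ∣ ≤ Dist s t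
  withinHalf⇒≤dist {s} {t} h = ⊓-glb ≤-refl (m+n≤o⇒m≤o∸n ∣ s - t ∣ h)

  ≤dist⇒withinHalf : ∀ {s t} → s ≤ N → t ≤ N → ∣ s - t ∣ ≤ Dist s t → WithinHalf s t
  ≤dist⇒withinHalf {s} {t} s≤N t≤N h =
    m≤o∸n⇒m+n≤o ∣ s - t ∣ ∣s-t∣≤1+N (≤-trans h (m⊓n≤n ∣ s - t ∣ (suc N ∸ ∣ s - t ∣)))
    where
      ∣s-t∣≤1+N : ∣ s - t ∣ ≤ suc N
      ∣s-t∣≤1+N = ≤-trans (∣m-n∣≤m⊔n s t) (≤-trans (⊔-lub s≤N t≤N) (n≤1+n N))

  SameSide : ℕ → ℕ → ℕ → Set
  SameSide c s t = (c ≤ s × c ≤ t) ⊎ (s ≤ c × t ≤ c)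

  ∣-∣-sameSide : ∀ {c s t} → SameSide c s t → s ≤ t →
                 ∣ s - t ∣ ≤ ∣ c - s ∣ ⊎ ∣ s - t ∣ ≤ ∣ c - t ∣
  ∣-∣-sameSide {c} {s} {t} (inj₁ (c≤s , c≤t)) s≤t = inj₂ (begin
    ∣ s - t ∣  ≡⟨ m≤n⇒∣m-n∣≡n∸m s≤t ⟩
    t ∸ s      ≤⟨ ∸-monoʳ-≤ t c≤s ⟩
    t ∸ c      ≡⟨ sym (m≤n⇒∣m-n∣≡n∸m c≤t) ⟩
    ∣ c - t ∣  ∎)
    where open ≤-Reasoning
  ∣-∣-sameSide {c} {s} {t} (inj₂ (s≤c , t≤c)) s≤t = inj₁ (begin
    ∣ s - t ∣  ≡⟨ m≤n⇒∣m-n∣≡n∸m s≤t ⟩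
    t ∸ s      ≤⟨ ∸-monoˡ-≤ s t≤c ⟩
    c ∸ s      ≡⟨ sym (m≤n⇒∣n-m∣≡n∸m s≤c) ⟩
    ∣ c - s ∣  ∎)
    where open ≤-Reasoning

  withinHalf-sameSide-≤ : ∀ {c s t} → SameSide c s t → s ≤ t →
                          WithinHalf c s → WithinHalf c t → WithinHalf s t
  withinHalf-sameSide-≤ side s≤t hs ht with ∣-∣-sameSide side s≤t
  ... | inj₁ ≤∣c-s∣ = ≤-trans (+-mono-≤ ≤∣c-s∣ ≤∣c-s∣) hs
  ... | inj₂ ≤∣c-t∣ = ≤-trans (+-mono-≤ ≤∣c-t∣ ≤∣c-t∣) ht

  withinHalf-sameSide : ∀ {c s t} → SameSide c s t → WithinHalf c s → WithinHalf c t → WithinHalf s t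
  withinHalf-sameSide {c} {s} {t} side hs ht with ≤-total s t
  ... | inj₁ s≤t = withinHalf-sameSide-≤ {c} side s≤t hs ht
  ... | inj₂ t≤s = withinHalf-sym {t} {s} (withinHalf-sameSide-≤ {c} (swapSides side) t≤s ht hs)
    where
      swapSides : ∀ {c s t} → SameSide c s t → SameSide c t s
      swapSides (inj₁ (c≤s , c≤t)) = inj₁ (c≤t , c≤s)
      swapSides (inj₂ (s≤c , t≤c)) = inj₂ (t≤c , s≤c)

cycleAdj-sym : ∀ {n} {y z : Fin n} → CycleAdj n y z → CycleAdj n z y
cycleAdj-sym (inj₁ e) = inj₂ (inj₁ e)
cycleAdj-sym (inj₂ (inj₁ e)) = inj₁ e
cycleAdj-sym (inj₂ (inj₂ (inj₁ e))) = inj₂ (inj₂ (inj₂ e))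
cycleAdj-sym (inj₂ (inj₂ (inj₂ e))) = inj₂ (inj₂ (inj₁ e))

module CyclePositions (N : ℕ) (a : Fin (suc N)) where

  open CycleArithmetic N
  open WalkProperties (Cycle (suc N))
  open Symmetric cycleAdj-sym

  G : Graph (suc N)
  G = Cycle (suc N)

  -- Rotation putting a at position N; the edge N ~ 0 between a and its successor is the seam.
  pos : Fin (suc N) → ℕ
  pos y = (toℕ y + (N ∸ toℕ a)) % suc N

  pos≤N : ∀ y → pos y ≤ N
  pos≤N y = ≤-pred (m%n<n (toℕ y + (N ∸ toℕ a)) (suc N))

  pos-anchor : pos a ≡ N
  pos-anchor = trans (cong (_% suc N) (m+[n∸m]≡n (≤-pred (toℕ<n a)))) (m≤n⇒m%n≡m ≤-refl)

  toℕ-% : ∀ y → toℕ y % suc N ≡ toℕ y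
  toℕ-% y = m<n⇒m%n≡m (toℕ<n y)

  pos-injective : ∀ {y z} → pos y ≡ pos z → y ≡ z
  pos-injective {y} {z} eq = toℕ-injective (begin
    toℕ y           ≡⟨ sym (toℕ-% y) ⟩
    toℕ y % suc N   ≡⟨ Equivalence.from (%-translate (toℕ y) (toℕ z) (N ∸ toℕ a)) eq ⟩
    toℕ z % suc N   ≡⟨ toℕ-% z ⟩
    toℕ z           ∎)
    where open ≡-Reasoning

  vertex : ℕ → Fin (suc N)
  vertex c = (c + suc (toℕ a)) mod suc N

  pos-vertex : ∀ {c} → c ≤ N → pos (vertex c) ≡ c
  pos-vertex {c} c≤N = begin
    (toℕ (vertex c) + k) % suc N
      ≡⟨ cong (λ r → (r + k) % suc N) (toℕ-fromℕ< (m%n<n (c + suc A) (suc N))) ⟩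
    ((c + suc A) % suc N + k) % suc N          ≡⟨ sym (%-absorbˡ (c + suc A) k) ⟩
    ((c + suc A) + k) % suc N                  ≡⟨ cong (_% suc N) (+-assoc c (suc A) k) ⟩
    (c + suc (A + k)) % suc N                  ≡⟨ cong (λ r → (c + suc r) % suc N) (m+[n∸m]≡n (≤-pred (toℕ<n a))) ⟩
    (c + suc N) % suc N                        ≡⟨ [m+n]%n≡m%n c (suc N) ⟩
    c % suc N                                  ≡⟨ m≤n⇒m%n≡m c≤N ⟩
    c                                          ∎
    where
      open ≡-Reasoning
      A = toℕ a
      k = N ∸ toℕ a

  step⇒pos-step : ∀ {y z} → Step (toℕ y) (toℕ z) → Step (pos y) (pos z)
  step⇒pos-step {y} {z} step = suc-%⇒step (pos≤N y) (pos≤N z) (begin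
    suc (pos y) % suc N         ≡⟨ suc-% (toℕ y + k) ⟩
    (suc (toℕ y) + k) % suc N   ≡⟨ Equivalence.to (%-translate (suc (toℕ y)) (toℕ z) k) (step⇒suc-% step) ⟩
    (toℕ z + k) % suc N         ≡⟨ sym (m%n%n≡m%n (toℕ z + k) (suc N)) ⟩
    pos z % suc N               ∎)
    where
      open ≡-Reasoning
      k = N ∸ toℕ a

  pos-step⇒step : ∀ {y z} → Step (pos y) (pos z) → Step (toℕ y) (toℕ z)
  pos-step⇒step {y} {z} step = suc-%⇒step (≤-pred (toℕ<n y)) (≤-pred (toℕ<n z))
    (Equivalence.from (%-translate (suc (toℕ y)) (toℕ z) k) (begin
      (suc (toℕ y) + k) % suc N   ≡⟨ sym (suc-% (toℕ y + k)) ⟩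
      suc (pos y) % suc N         ≡⟨ step⇒suc-% step ⟩
      pos z % suc N               ≡⟨ m%n%n≡m%n (toℕ z + k) (suc N) ⟩
      (toℕ z + k) % suc N         ∎))
    where
      open ≡-Reasoning
      k = N ∸ toℕ a

  adj⇒pos-adj : ∀ {y z} → G y z → Adjacentℕ (pos y) (pos z)
  adj⇒pos-adj e = Data.Sum.map step⇒pos-step step⇒pos-step (cycleAdj⇒adjacentℕ e)

  pos-adj⇒adj : ∀ {y z} → Adjacentℕ (pos y) (pos z) → G y z
  pos-adj⇒adj adj = adjacentℕ⇒cycleAdj (Data.Sum.map pos-step⇒step pos-step⇒step adj)

  dist-≤-length : ∀ {k u v} (P : Walk G k u v) → Dist (pos u) (pos v) ≤ k
  dist-≤-length {k} {u} {v} P =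
    subst (Dist (pos u) (pos v) ≤_) (trans (cong (k +_) (dist-self (pos v))) (+-identityʳ k))
      (potential-≤-length (λ x → Dist (pos x) (pos v)) (λ _ → ⊤)
        (λ _ _ e → dist-adjacent (pos≤N v) (adj⇒pos-adj e)) P (λ _ _ → tt))

  ≤-dist⇒shortest : ∀ {k u v} (P : Walk G k u v) → k ≤ Dist (pos u) (pos v) → IsShortest G P
  ≤-dist⇒shortest P k≤dist m m<k R = <⇒≱ (<-≤-trans m<k k≤dist) (dist-≤-length R)

  arc : ∀ d {u v} → pos u + d ≡ pos v →
        Σ (Walk G d u v) λ P → ∀ x → OnWalk G x P → pos u ≤ pos x × pos x ≤ pos v
  arc zero {u} {v} eq with pos-injective {u} {v} (trans (sym (+-identityʳ (pos u))) eq)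
  ... | refl = nil , λ x o →
    subst (λ y → pos u ≤ pos y × pos y ≤ pos u) (sym (onWalk-nil o)) (≤-refl , ≤-refl)
  arc (suc d) {u} {v} eq = cons edge (proj₁ rest) , bounds
    where
      w = vertex (suc (pos u))
      eq′ : suc (pos u) + d ≡ pos v
      eq′ = trans (sym (+-suc (pos u) d)) eq
      pos-w : pos w ≡ suc (pos u)
      pos-w = pos-vertex (≤-trans (m≤m+n (suc (pos u)) d) (subst (_≤ N) (sym eq′) (pos≤N v)))
      edge : G u w
      edge = pos-adj⇒adj (inj₁ (inj₁ (sym pos-w)))
      rest = arc d {w} {v} (trans (cong (_+ d) pos-w) eq′)
      bounds : ∀ x → OnWalk G x (cons edge (proj₁ rest)) → pos u ≤ pos x × pos x ≤ pos v
      bounds _ here = ≤-refl , subst (pos u ≤_) eq (m≤m+n (pos u) (suc d))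
      bounds x (there o) with proj₂ rest x o
      ... | w≤x , x≤v = ≤-trans (n≤1+n (pos u)) (subst (_≤ pos x) pos-w w≤x) , x≤v

  dist-ordered : ∀ {s t} → s ≤ t → Dist s t ≡ (t ∸ s) ⊓ (suc N ∸ (t ∸ s))
  dist-ordered s≤t = cong (λ d → d ⊓ (suc N ∸ d)) (m≤n⇒∣m-n∣≡n∸m s≤t)

  -- Going the other way round: from u down to position 0, across the seam to a, then down to v.
  wrap : ∀ {u v} → pos u ≤ pos v → Walk G (suc N ∸ (pos v ∸ pos u)) u v
  wrap {u} {v} pu≤pv = subst (λ l → Walk G l u v) length≡ (down-to-0 ++ cons seam down-from-a)
    where
      z = vertex 0
      pos-z : pos z ≡ 0
      pos-z = pos-vertex z≤n
      down-to-0 = reverse (proj₁ (arc (pos u) {z} {u} (cong (_+ pos u) pos-z)))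
      seam : G z a
      seam = pos-adj⇒adj (inj₂ (inj₂ (pos-anchor , pos-z)))
      down-from-a = reverse (proj₁ (arc (N ∸ pos v) {v} {a} (trans (m+[n∸m]≡n (pos≤N v)) (sym pos-anchor))))
      shuffle : ∀ x y z → (x + suc y) + z ≡ suc ((x + z) + y)
      shuffle = solve-∀
      length+gap : (pos u + suc (N ∸ pos v)) + (pos v ∸ pos u) ≡ suc N
      length+gap = begin
        (pos u + suc (N ∸ pos v)) + (pos v ∸ pos u)    ≡⟨ shuffle (pos u) (N ∸ pos v) (pos v ∸ pos u) ⟩
        suc ((pos u + (pos v ∸ pos u)) + (N ∸ pos v))  ≡⟨ cong (λ r → suc (r + (N ∸ pos v))) (m+[n∸m]≡n pu≤pv) ⟩
        suc (pos v + (N ∸ pos v))                      ≡⟨ cong suc (m+[n∸m]≡n (pos≤N v)) ⟩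
        suc N                                          ∎
        where open ≡-Reasoning
      length≡ : pos u + suc (N ∸ pos v) ≡ suc N ∸ (pos v ∸ pos u)
      length≡ = trans (sym (m+n∸n≡m _ (pos v ∸ pos u))) (cong (_∸ (pos v ∸ pos u)) length+gap)

  walk-within-dist-≤ : ∀ {u v} → pos u ≤ pos v → Σ ℕ λ k → Walk G k u v × k ≤ Dist (pos u) (pos v)
  walk-within-dist-≤ {u} {v} pu≤pv rewrite dist-ordered pu≤pv with pos v ∸ pos u ≤? suc N ∸ (pos v ∸ pos u)
  ... | yes short = _ , proj₁ (arc _ (m+[n∸m]≡n pu≤pv)) , ⊓-glb ≤-refl short
  ... | no long = _ , wrap pu≤pv , ⊓-glb (<⇒≤ (≰⇒> long)) ≤-refl

  walk-within-dist : ∀ u v → Σ ℕ λ k → Walk G k u v × k ≤ Dist (pos u) (pos v)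
  walk-within-dist u v with ≤-total (pos u) (pos v)
  ... | inj₁ pu≤pv = walk-within-dist-≤ pu≤pv
  ... | inj₂ pv≤pu with walk-within-dist-≤ pv≤pu
  ...   | k , P , k≤dist = k , reverse P , subst (k ≤_) (dist-comm (pos v) (pos u)) k≤dist

  shortest-walk : ∀ u v → Σ ℕ λ k → Σ (Walk G k u v) (IsShortest G)
  shortest-walk u v with walk-within-dist u v
  ... | k , P , k≤dist = k , P , ≤-dist⇒shortest P k≤dist

  shortest⇒≤-dist : ∀ {k u v} {P : Walk G k u v} → IsShortest G P → k ≤ Dist (pos u) (pos v)
  shortest⇒≤-dist {u = u} {v} {P} sh with walk-within-dist u v
  ... | _ , R , l≤dist = ≤-trans (shortest-≤ {P = P} sh R) l≤dist

  step-off-seam : ∀ {c s t} → c ≡ 0 ⊎ c ≡ N → s ≢ c → t ≢ c → Step s t → suc s ≡ t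
  step-off-seam _ _ _ (inj₁ suc-s≡t) = suc-s≡t
  step-off-seam (inj₁ refl) _ t≢0 (inj₂ (_ , t≡0)) = ⊥-elim (t≢0 t≡0)
  step-off-seam (inj₂ refl) s≢N _ (inj₂ (s≡N , _)) = ⊥-elim (s≢N s≡N)

  ∣-∣-≤-length : ∀ {c k u v} → c ≡ 0 ⊎ c ≡ N → (P : Walk G k u v) →
                 (∀ x → OnWalk G x P → pos x ≢ c) → ∣ pos u - pos v ∣ ≤ k
  ∣-∣-≤-length {c} {k} {u} {v} seam P avoids =
    subst (∣ pos u - pos v ∣ ≤_) (trans (cong (k +_) (∣n-n∣≡0 (pos v))) (+-identityʳ k))
      (potential-≤-length (λ x → ∣ pos x - pos v ∣) (λ x → pos x ≢ c) lipschitz P avoids)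
    where
      lipschitz : ∀ {y z} → pos y ≢ c → pos z ≢ c → G y z → ∣ pos y - pos v ∣ ≤ suc ∣ pos z - pos v ∣
      lipschitz {y} {z} y≢c z≢c e with adj⇒pos-adj e
      ... | inj₁ step = subst (λ t → ∣ pos y - pos v ∣ ≤ suc ∣ t - pos v ∣)
                          (step-off-seam seam y≢c z≢c step) (proj₁ (∣-∣-suc (pos y) (pos v)))
      ... | inj₂ step = subst (λ t → ∣ t - pos v ∣ ≤ suc ∣ pos z - pos v ∣)
                          (step-off-seam seam z≢c y≢c step) (proj₂ (∣-∣-suc (pos z) (pos v)))

  -- Missing an endpoint of the seam, a shortest path cannot wrap around, so its length is ∣ pos u - pos v ∣.
  visible⇒withinHalf : ∀ {X w u v} → w ∈ X → w ≢ u → w ≢ v → pos w ≡ 0 ⊎ pos w ≡ N →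
                       Visible G X u v → WithinHalf (pos u) (pos v)
  visible⇒withinHalf {w = w} {u} {v} w∈X w≢u w≢v seam (k , P , sh , av) =
    ≤dist⇒withinHalf (pos≤N u) (pos≤N v)
      (≤-trans (∣-∣-≤-length seam P avoids-w) (shortest⇒≤-dist {P = P} sh))
    where
      avoids-w : ∀ x → OnWalk G x P → pos x ≢ pos w
      avoids-w x o eq with pos-injective {x} {w} eq
      ... | refl = [ w≢u , w≢v ] (av x o w∈X)

  arc-visible : ∀ {X u v} → pos u ≤ pos v → WithinHalf (pos u) (pos v) →
                (∀ x → x ∈ X → pos u < pos x → pos x < pos v → ⊥) → Visible G X u v
  arc-visible {X} {u} {v} pu≤pv half nothing-between = d , P , ≤-dist⇒shortest P d≤dist , avoids
    where
      d = pos v ∸ pos u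
      path = arc d (m+[n∸m]≡n pu≤pv)
      P = proj₁ path
      d≤dist : d ≤ Dist (pos u) (pos v)
      d≤dist = subst (_≤ Dist (pos u) (pos v)) (m≤n⇒∣m-n∣≡n∸m pu≤pv)
                     (withinHalf⇒≤dist {pos u} {pos v} half)
      avoids : ∀ x → OnWalk G x P → x ∈ X → x ≡ u ⊎ x ≡ v
      avoids x o x∈X with proj₂ path x o
      ... | pu≤px , px≤pv with m≤n⇒m<n∨m≡n pu≤px | m≤n⇒m<n∨m≡n px≤pv
      ... | inj₂ pu≡px | _ = inj₁ (pos-injective (sym pu≡px))
      ... | _ | inj₂ px≡pv = inj₂ (pos-injective px≡pv)
      ... | inj₁ pu<px | inj₁ px<pv = ⊥-elim (nothing-between x x∈X pu<px px<pv)

  walk-keeps-side : ∀ {c k u v} (P : Walk G k u v) → (∀ x → OnWalk G x P → pos x ≢ N × pos x ≢ c) →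
                    (pos u < c → pos v < c) × (c < pos u → c < pos v)
  walk-keeps-side {c} P avoids =
    walk-preserves (λ x → pos x < c) Avoids below P avoids ,
    walk-preserves (λ x → c < pos x) Avoids above P avoids
    where
      Avoids : Fin (suc N) → Set
      Avoids x = pos x ≢ N × pos x ≢ c
      below : ∀ {y z} → Avoids y → Avoids z → G y z → pos y < c → pos z < c
      below (y≢N , _) (z≢N , z≢c) e y<c with adj⇒pos-adj e
      ... | inj₁ step = ≤∧≢⇒< (subst (_≤ c) (step-off-seam (inj₂ refl) y≢N z≢N step) y<c) z≢c
      ... | inj₂ step = <-trans (≤-reflexive (step-off-seam (inj₂ refl) z≢N y≢N step)) y<c
      above : ∀ {y z} → Avoids y → Avoids z → G y z → c < pos y → c < pos z
      above (y≢N , _) (z≢N , z≢c) e c<y with adj⇒pos-adj e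
      ... | inj₁ step = <-trans c<y (≤-reflexive (step-off-seam (inj₂ refl) y≢N z≢N step))
      ... | inj₂ step = ≤∧≢⇒< (≤-pred (subst (c <_) (sym (step-off-seam (inj₂ refl) z≢N y≢N step)) c<y))
                               (z≢c ∘ sym)

  step-from-anchor : ∀ {y} → Step (toℕ a) (toℕ y) → pos y ≡ 0
  step-from-anchor {y} step with subst (λ s → Step s (pos y)) pos-anchor (step⇒pos-step step)
  ... | inj₁ suc-N≡pos-y = ⊥-elim (<⇒≱ (≤-reflexive suc-N≡pos-y) (pos≤N y))
  ... | inj₂ (_ , pos-y≡0) = pos-y≡0

module TwoVertices (N : ℕ) (a b : Fin (suc N)) (a≢b : a ≢ b) where

  open CycleArithmetic N
  open CyclePositions N a
  open WalkProperties G
  open Symmetric cycleAdj-sym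

  Q : Subset (suc N)
  Q = ⁅ a ⁆ ∪ ⁅ b ⁆

  open CQVisibleSets G Q

  Vis : Fin (suc N) → Fin (suc N) → Set
  Vis = Visible G Q

  β : ℕ
  β = pos b

  a∈Q : a ∈ Q
  a∈Q = x∈p∪q⁺ (inj₁ (x∈⁅x⁆ a))

  b∈Q : b ∈ Q
  b∈Q = x∈p∪q⁺ (inj₂ (x∈⁅x⁆ b))

  ∉Q⇒≢ : ∀ {x y} → x ∈ Q → y ∉ Q → x ≢ y
  ∉Q⇒≢ x∈Q y∉Q refl = y∉Q x∈Q

  ∉Q⇒pos≢ : ∀ {y} → y ∉ Q → pos y ≢ N × pos y ≢ β
  ∉Q⇒pos≢ {y} y∉Q =
    (λ eq → ∉Q⇒≢ a∈Q y∉Q (pos-injective (trans pos-anchor (sym eq)))) ,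
    (λ eq → ∉Q⇒≢ b∈Q y∉Q (pos-injective (sym eq)))

  Q-mutual : MutualVisibilitySet G Q
  Q-mutual = mutualVisibility-pair shortest-walk a b

  b-visible⇒withinHalf : ∀ {y} → Vis b y → y ∉ Q → WithinHalf β (pos y)
  b-visible⇒withinHalf b-y y∉Q = visible⇒withinHalf a∈Q a≢b (∉Q⇒≢ a∈Q y∉Q) (inj₂ pos-anchor) b-y

  arc-visible-Q : ∀ {u v} → pos u ≤ pos v → WithinHalf (pos u) (pos v) → ¬ (pos u < β × β < pos v) → Vis u v
  arc-visible-Q {u} {v} pu≤pv half β-outside = arc-visible pu≤pv half between
    where
      between : ∀ x → x ∈ Q → pos u < pos x → pos x < pos v → ⊥
      between x x∈Q pu<px px<pv with ∈-pair⁻ x∈Q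
      ... | inj₁ refl = <⇒≱ (subst (_< pos v) pos-anchor px<pv) (pos≤N v)
      ... | inj₂ refl = β-outside (pu<px , px<pv)

  StrictSide : ℕ → ℕ → Set
  StrictSide s t = (s < β × t < β) ⊎ (β < s × β < t)

  visible-sides : ∀ {u v} → Vis u v → u ∉ Q → v ∉ Q → (pos u < β → pos v < β) × (β < pos u → β < pos v)
  visible-sides {u} {v} (_ , P , _ , av) u∉Q v∉Q = walk-keeps-side P (λ x o → ∉Q⇒pos≢ (on-P∉Q x o))
    where
      on-P∉Q : ∀ x → OnWalk G x P → x ∉ Q
      on-P∉Q x o x∈Q with av x o x∈Q
      ... | inj₁ refl = u∉Q x∈Q
      ... | inj₂ refl = v∉Q x∈Q

  visible-through⇒strictSide : ∀ {u x v} → u ∉ Q → x ∉ Q → v ∉ Q → Vis u x → Vis x v →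
                               StrictSide (pos u) (pos v)
  visible-through⇒strictSide {u} {x} {v} u∉Q x∉Q v∉Q u-x x-v = by-cmp (<-cmp (pos u) β)
    where
      below : pos u < β → pos v < β
      below = proj₁ (visible-sides x-v x∉Q v∉Q) ∘ proj₁ (visible-sides u-x u∉Q x∉Q)
      above : β < pos u → β < pos v
      above = proj₂ (visible-sides x-v x∉Q v∉Q) ∘ proj₂ (visible-sides u-x u∉Q x∉Q)
      by-cmp : Tri (pos u < β) (pos u ≡ β) (β < pos u) → StrictSide (pos u) (pos v)
      by-cmp (tri< pu<β _ _) = inj₁ (pu<β , below pu<β)
      by-cmp (tri≈ _ pu≡β _) = ⊥-elim (proj₂ (∉Q⇒pos≢ u∉Q) pu≡β)
      by-cmp (tri> _ _ β<pu) = inj₂ (β<pu , above β<pu)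

  strictSide-visible-≤ : ∀ {u v} → pos u ≤ pos v → StrictSide (pos u) (pos v) →
                         WithinHalf β (pos u) → WithinHalf β (pos v) → Vis u v
  strictSide-visible-≤ pu≤pv side hu hv =
    arc-visible-Q pu≤pv (withinHalf-sameSide (weaken side) hu hv) (outside side)
    where
      weaken : StrictSide _ _ → SameSide β _ _
      weaken (inj₁ (pu<β , pv<β)) = inj₂ (<⇒≤ pu<β , <⇒≤ pv<β)
      weaken (inj₂ (β<pu , β<pv)) = inj₁ (<⇒≤ β<pu , <⇒≤ β<pv)
      outside : StrictSide _ _ → ¬ (_ < β × β < _)
      outside (inj₁ (_ , pv<β)) (_ , β<pv) = <-asym pv<β β<pv
      outside (inj₂ (β<pu , _)) (pu<β , _) = <-asym pu<β β<pu

  strictSide-visible : ∀ {u v} → StrictSide (pos u) (pos v) →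
                       WithinHalf β (pos u) → WithinHalf β (pos v) → Vis u v
  strictSide-visible {u} {v} side hu hv with ≤-total (pos u) (pos v)
  ... | inj₁ pu≤pv = strictSide-visible-≤ pu≤pv side hu hv
  ... | inj₂ pv≤pu = visible-sym (strictSide-visible-≤ pv≤pu flipped hv hu)
    where flipped = Data.Sum.map Data.Product.swap Data.Product.swap side

  visible-through : ∀ {u x v} → u ∉ Q → x ∉ Q → v ∉ Q → Vis u x → Vis x v → Vis b u → Vis b v → Vis u v
  visible-through u∉Q x∉Q v∉Q u-x x-v b-u b-v =
    strictSide-visible (visible-through⇒strictSide u∉Q x∉Q v∉Q u-x x-v)
      (b-visible⇒withinHalf b-u u∉Q) (b-visible⇒withinHalf b-v v∉Q)

  maximal-overlap⇒≡ : ∀ {W W′ x} → Maximal W → Maximal W′ → x ∈ W → x ∈ W′ → W ≡ W′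
  maximal-overlap⇒≡ {W} {W′} {x} maxW@(absW@((W⊆ , visW , visQW) , _) , _)
                    maxW′@(absW′@((W′⊆ , visW′ , visQW′) , _) , _) x∈W x∈W′ =
    maximal-∪-absolute⇒≡ maxW maxW′ (∪-absolute absW absW′ cross)
    where
      cross : ∀ {u v} → u ∈ W → v ∈ W′ → Vis u v × Vis v u
      cross {u} {v} u∈W v∈W′ = u-v , visible-sym u-v
        where
          u-v = visible-through (x∈∁p⇒x∉p (W⊆ u∈W)) (x∈∁p⇒x∉p (W⊆ x∈W)) (x∈∁p⇒x∉p (W′⊆ v∈W′))
                  (visW u x u∈W x∈W) (visW′ x v x∈W′ v∈W′) (visQW b u b∈Q u∈W) (visQW′ b v b∈Q v∈W′)

  module Adjacent (β≡0 : β ≡ 0) where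

    Middle : ℕ → Set
    Middle t = β < t × t < N × WithinHalf t N × WithinHalf β t

    middle? : Decidable Middle
    middle? t = (β <? t) ×-dec (t <? N) ×-dec (_ ≤? suc N) ×-dec (_ ≤? suc N)

    W₀ : Subset (suc N)
    W₀ = fromDec (middle? ∘ pos)

    a-visible⇒withinHalf : ∀ {y} → Vis a y → y ∉ Q → WithinHalf (pos y) N
    a-visible⇒withinHalf {y} a-y y∉Q = subst (WithinHalf (pos y)) pos-anchor
      (withinHalf-sym {pos a} (visible⇒withinHalf b∈Q (a≢b ∘ sym) (∉Q⇒≢ b∈Q y∉Q) (inj₁ β≡0) a-y))

    absolute⊆W₀ : ∀ W → Absolute W → W ⊆ W₀
    absolute⊆W₀ W ((W⊆ , _ , visQW) , _) {y} y∈W = ∈-fromDec⁺ (middle? ∘ pos)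
      ( ≤∧≢⇒< (subst (_≤ pos y) (sym β≡0) z≤n) (py≢β ∘ sym)
      , ≤∧≢⇒< (pos≤N y) py≢N
      , a-visible⇒withinHalf (visQW a y a∈Q y∈W) y∉Q
      , b-visible⇒withinHalf (visQW b y b∈Q y∈W) y∉Q)
      where
        y∉Q = x∈∁p⇒x∉p (W⊆ y∈W)
        py≢N = proj₁ (∉Q⇒pos≢ y∉Q)
        py≢β = proj₂ (∉Q⇒pos≢ y∉Q)

    W₀-absolute : Absolute W₀
    W₀-absolute = (W₀⊆∁Q , pairs , fromQ) , Q-mutual
      where
        middle : ∀ {y} → y ∈ W₀ → Middle (pos y)
        middle = ∈-fromDec⁻ (middle? ∘ pos)
        W₀⊆∁Q : W₀ ⊆ ∁ Q
        W₀⊆∁Q {y} y∈W₀ = x∉p⇒x∈∁p y∉Q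
          where
            y∉Q : y ∉ Q
            y∉Q y∈Q with ∈-pair⁻ y∈Q | middle y∈W₀
            ... | inj₁ refl | _ , pa<N , _ = <-irrefl pos-anchor pa<N
            ... | inj₂ refl | β<β , _ = <-irrefl refl β<β
        pairs : SetVisible G Q W₀
        pairs u v u∈W₀ v∈W₀ with middle u∈W₀ | middle v∈W₀
        ... | β<pu , _ , _ , hu | β<pv , _ , _ , hv = strictSide-visible (inj₂ (β<pu , β<pv)) hu hv
        fromQ : ∀ u w → u ∈ Q → w ∈ W₀ → Vis u w
        fromQ u w u∈Q w∈W₀ with ∈-pair⁻ u∈Q | middle w∈W₀
        ... | inj₁ refl | β<pw , _ , half , _ = visible-sym (arc-visible-Q
                (subst (pos w ≤_) (sym pos-anchor) (pos≤N w))
                (subst (WithinHalf (pos w)) (sym pos-anchor) half)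
                (λ (pw<β , _) → <-asym pw<β β<pw))
        ... | inj₂ refl | β<pw , _ , _ , half =
                arc-visible-Q (<⇒≤ β<pw) half (λ (β<β , _) → <-irrefl refl β<β)

    unique-maximal : HasUniqueMaximal G Q
    unique-maximal = greatest⇒unique-maximal W₀-absolute absolute⊆W₀

mainTheorem14 : (n : ℕ) → 3 ≤ n → (a b : Fin n) → a ≢ b →
    (CycleAdj n a b →
      Σ (Subset n) λ W →
        MaximalAbsoluteCQVisible (Cycle n) (⁅ a ⁆ ∪ ⁅ b ⁆) W ×
        (∀ W' → MaximalAbsoluteCQVisible (Cycle n) (⁅ a ⁆ ∪ ⁅ b ⁆) W' → W' ≡ W))
    × (¬ CycleAdj n a b →
      ∀ W W' →
        MaximalAbsoluteCQVisible (Cycle n) (⁅ a ⁆ ∪ ⁅ b ⁆) W →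
        MaximalAbsoluteCQVisible (Cycle n) (⁅ a ⁆ ∪ ⁅ b ⁆) W' →
        W ≢ W' → ∀ x → x ∈ W → x ∈ W' → ⊥)
mainTheorem14 (suc N) _ a b a≢b = adjacent , nonAdjacent
  where
    open CycleArithmetic N using (cycleAdj⇒adjacentℕ)
    open CQVisibleSets (Cycle (suc N)) (⁅ a ⁆ ∪ ⁅ b ⁆) using (Maximal)

    adjacent : CycleAdj (suc N) a b → HasUniqueMaximal (Cycle (suc N)) (⁅ a ⁆ ∪ ⁅ b ⁆)
    adjacent a~b with cycleAdj⇒adjacentℕ a~b
    ... | inj₁ a→b = TwoVertices.Adjacent.unique-maximal N a b a≢b (CyclePositions.step-from-anchor N a a→b)
    ... | inj₂ b→a = subst (HasUniqueMaximal (Cycle (suc N))) (∪-comm ⁅ b ⁆ ⁅ a ⁆)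
            (TwoVertices.Adjacent.unique-maximal N b a (a≢b ∘ sym) (CyclePositions.step-from-anchor N b b→a))

    nonAdjacent : ¬ CycleAdj (suc N) a b → ∀ W W′ → Maximal W → Maximal W′ →
                  W ≢ W′ → ∀ x → x ∈ W → x ∈ W′ → ⊥
    nonAdjacent _ W W′ maxW maxW′ W≢W′ x x∈W x∈W′ =
      W≢W′ (TwoVertices.maximal-overlap⇒≡ N a b a≢b maxW maxW′ x∈W x∈W′)
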